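{- Let $f_0(i)=i$ for $i=1,2,\ldots$, and let $f_m$, $c_m(n,k)$ be as in the context. Then for all integers $m\ge1$ and $1\le k\le n$, $c_m(n,k)$ equals the number of words of length $n-1$ over the alphabet $\{0,1,\ldots,m+1\}$ having exactly $k-1$ letters equal to $m+1$ and not containing $01$ as a factor (i.e. no $0$ is immediately followed by $1$).
   Context: For $m\ge1$, $f_m$ is the $m$th invert transform of $f_0$: $f_m(0)=1$ and $f_m(n)=\sum_{i=1}^{n} f_{m-1}(i)\,f_m(n-i)$ for $n\ge1$. For $m\ge1$ and $0\le k\le n$: $c_m(0,0)=1$, $c_m(n,0)=0$ for $n\ge1$, and $c_m(n,k)=\sum_{i=1}^{n-k+1} f_{m-1}(i)\,c_m(n-i,k-1)$ for $1\le k\le n$. -}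

module Defs where

open import Data.Nat using (ℕ; zero; suc; _+_; _*_; _∸_)
import Data.Nat as ℕ
open import Data.Fin using (Fin; zero; suc; fromℕ)
import Data.Fin as F
open import Data.List using (List; []; _∷_; map; zipWith; upTo; concatMap; filter; length)
import Data.List as L
open import Data.Nat.ListAction using (sum)
open import Data.Vec using (Vec; []; _∷_; toList; count)
open import Data.List.Relation.Unary.Linked using (Linked; linked?)
open import Data.Product using (_×_; _,_)
open import Relation.Binary.PropositionalEquality using (_≡_)
open import Relation.Nullary using (¬_; Dec)
open import Relation.Nullary.Decidable using (_×-dec_; ¬?)

-- Invert transform.
-- For g : ℕ → ℕ, (invert g) 0 = 1 and
-- (invert g) n = Σ_{i=1}^{n} g(i) · (invert g)(n - i)  for n ≥ 1.
-- table g n = [a_n , a_{n-1} , … , a_0]  where a = invert g.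

table : (ℕ → ℕ) → ℕ → List ℕ
table g zero    = 1 ∷ []
table g (suc n) =
  sum (zipWith _*_ (map (λ i → g (suc i)) (upTo (suc n))) (table g n)) ∷ table g n
  -- entry i (0-based) of the zip is g (i+1) · a_{n-i} = g (i+1) · a_{(n+1)-(i+1)}

head0 : List ℕ → ℕ
head0 []      = 0
head0 (x ∷ _) = x

invert : (ℕ → ℕ) → ℕ → ℕ
invert g n = head0 (table g n)

f : ℕ → ℕ → ℕ
f zero    i = i
f (suc m) n = invert (f m) n

cg : (ℕ → ℕ) → ℕ → ℕ → ℕ
cg g zero    zero    = 1
cg g (suc n) zero    = 0
cg g n       (suc k) = sum (map (λ j → g (suc j) * cg g (n ∸ suc j) k) (upTo ((n + 1) ∸ suc k)))

-- c m n k  is  c_m(n,k)  (meaningful for m ≥ 1).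
c : ℕ → ℕ → ℕ → ℕ
c m n k = cg (f (m ∸ 1)) n k

words : (a l : ℕ) → List (Vec (Fin a) l)
words a zero    = [] ∷ []
words a (suc l) = concatMap (λ x → map (x ∷_) (words a l)) (L.allFin a)

Not01 : ∀ {a} → Fin (suc (suc a)) → Fin (suc (suc a)) → Set
Not01 x y = ¬ (x ≡ zero × y ≡ suc zero)

not01? : ∀ {a} (x y : Fin (suc (suc a))) → Dec (Not01 x y)
not01? x y = ¬? ((x F.≟ zero) ×-dec (y F.≟ suc zero))

Avoids01 : ∀ {a l} → Vec (Fin (suc (suc a))) l → Set
Avoids01 w = Linked Not01 (toList w)

numTop : ∀ {m l} → Vec (Fin (suc (suc m))) l → ℕ
numTop {m} w = count (F._≟ fromℕ (suc m)) w

Good : (m j : ℕ) {l : ℕ} → Vec (Fin (suc (suc m))) l → Set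
Good m j w = (numTop w ≡ j) × Avoids01 w

good? : (m j : ℕ) {l : ℕ} (w : Vec (Fin (suc (suc m))) l) → Dec (Good m j w)
good? m j w = (numTop w ℕ.≟ j) ×-dec linked? not01? (toList w)

countWords : (m l j : ℕ) → ℕ
countWords m l j = length (filter (good? m j) (words (suc (suc m)) l))

-- Classifying the 01-free words by their first letter gives a linear recurrence for their
-- numbers, refined by the number of top letters m+1 and by whether the word may follow a 0.
-- Splitting a word at its first top letter turns that recurrence into a convolution of the
-- top-free counts with the counts of words that start with the top letter. The same splitting
-- at the first occurrence of the largest letter shows that the 01-free words over {0,…,m+1}
-- are counted by the invert transform of the counts over {0,…,m}; since f_0(l+1) = l+1 counts
-- the words 1…10…0, induction gives that f_{m-1}(l+1) counts the 01-free words of length l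
-- over {0,…,m}. Hence c_m(n,k) and the number of 01-free words of length n that start with the
-- top letter and contain k of them satisfy the same convolution recurrence in k.
module Submission where

open import Defs
open import Data.Bool using (Bool; true; false)
open import Data.Fin using (Fin; zero; suc; fromℕ)
import Data.Fin as F
open import Data.Fin.Properties using () renaming (suc-injective to fsuc-injective)
open import Data.List using (List; []; _∷_; _++_; map; filter; length; concatMap; applyUpTo; upTo; zipWith; tabulate; allFin)
open import Data.List.Properties using (length-++; filter-++; filter-≐; filter-none)
open import Data.List.Relation.Unary.All using (universal)
open import Data.List.Relation.Unary.Linked using ([]; [-]; _∷_)
open import Data.Nat using (ℕ; zero; suc; _+_; _*_; _∸_; _≤_; _<_; z≤n; s≤s; z<s; s<s)
open import Data.Nat.Induction using (<-rec)
open import Data.Nat.ListAction using (sum)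
open import Data.Nat.Properties
open import Algebra.Properties.CommutativeSemigroup +-commutativeSemigroup using (interchange)
open import Data.Product using (_×_; _,_; proj₁; proj₂)
open import Data.Unit using (⊤; tt)
open import Data.Vec using (Vec; []; _∷_)
open import Function using (_∘_)
open import Level using (0ℓ)
open import Relation.Binary.PropositionalEquality
open import Relation.Nullary using (¬_; Dec; yes; no; ¬?)
open import Relation.Nullary.Decidable using (_×-dec_; dec-true; dec-false)
open import Relation.Unary using (Pred; Decidable; _≐_)

open ≡-Reasoning

∑ : ℕ → (ℕ → ℕ) → ℕ
∑ zero    F = 0
∑ (suc n) F = F 0 + ∑ n (F ∘ suc)

∑-cong : ∀ n {F G : ℕ → ℕ} → (∀ i → i < n → F i ≡ G i) → ∑ n F ≡ ∑ n G
∑-cong zero    F≡G = refl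
∑-cong (suc n) F≡G = cong₂ _+_ (F≡G 0 z<s) (∑-cong n (λ i i<n → F≡G (suc i) (s<s i<n)))

∑-+ : ∀ n (F G : ℕ → ℕ) → ∑ n (λ i → F i + G i) ≡ ∑ n F + ∑ n G
∑-+ zero    F G = refl
∑-+ (suc n) F G =
  trans (cong (F 0 + G 0 +_) (∑-+ n (F ∘ suc) (G ∘ suc)))
        (interchange (F 0) (G 0) (∑ n (F ∘ suc)) (∑ n (G ∘ suc)))

∑-*ˡ : ∀ n c (F : ℕ → ℕ) → ∑ n (λ i → c * F i) ≡ c * ∑ n F
∑-*ˡ zero    c F = sym (*-zeroʳ c)
∑-*ˡ (suc n) c F =
  trans (cong (c * F 0 +_) (∑-*ˡ n c (F ∘ suc))) (sym (*-distribˡ-+ c (F 0) (∑ n (F ∘ suc))))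

∑-truncate : ∀ {m n} (F : ℕ → ℕ) → m ≤ n → (∀ i → m ≤ i → i < n → F i ≡ 0) → ∑ n F ≡ ∑ m F
∑-truncate {zero}  {zero}  F _         _      = refl
∑-truncate {zero}  {suc n} F _         vanish =
  cong₂ _+_ (vanish 0 z≤n z<s) (∑-truncate (F ∘ suc) z≤n (λ i _ i<n → vanish (suc i) z≤n (s<s i<n)))
∑-truncate {suc m} {suc n} F (s≤s m≤n) vanish =
  cong (F 0 +_) (∑-truncate (F ∘ suc) m≤n (λ i m≤i i<n → vanish (suc i) (s≤s m≤i) (s<s i<n)))

sum-map-applyUpTo : ∀ (F k : ℕ → ℕ) n → sum (map F (applyUpTo k n)) ≡ ∑ n (F ∘ k)
sum-map-applyUpTo F k zero    = refl
sum-map-applyUpTo F k (suc n) = cong (F (k 0) +_) (sum-map-applyUpTo F (k ∘ suc) n)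

n∸k≤i⇒n∸1+i<k : ∀ {n k i} → n ∸ k ≤ i → i < n → n ∸ suc i < k
n∸k≤i⇒n∸1+i<k {n} {k} {i} n∸k≤i i<n =
  ≤-trans (≤-reflexive (sym (+-∸-assoc 1 i<n))) (m≤n+o⇒m∸n≤o n i n≤i+k)
  where
  n≤i+k : n ≤ i + k
  n≤i+k = ≤-trans (m≤n+m∸n n k) (≤-trans (+-monoʳ-≤ k n∸k≤i) (≤-reflexive (+-comm k i)))

module _ {A : Set} {P : Pred A 0ℓ} (P? : Decidable P) where

  length-filter-map : ∀ {B : Set} (g : B → A) xs → length (filter P? (map g xs)) ≡ length (filter (P? ∘ g) xs)
  length-filter-map g []       = refl
  length-filter-map g (x ∷ xs) with P? (g x)
  ... | yes _ = cong suc (length-filter-map g xs)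
  ... | no  _ = length-filter-map g xs

  length-filter-map-≐ : ∀ {B : Set} {Q : Pred B 0ℓ} (Q? : Decidable Q) (g : B → A) → (P ∘ g) ≐ Q →
    ∀ xs → length (filter P? (map g xs)) ≡ length (filter Q? xs)
  length-filter-map-≐ Q? g P∘g≐Q xs = trans (length-filter-map g xs) (cong length (filter-≐ (P? ∘ g) Q? P∘g≐Q xs))

  length-filter-map-none : ∀ {B : Set} (g : B → A) → (∀ x → ¬ P (g x)) → ∀ xs → length (filter P? (map g xs)) ≡ 0
  length-filter-map-none g ¬P∘g xs = trans (length-filter-map g xs) (cong length (filter-none (P? ∘ g) (universal ¬P∘g xs)))

  length-filter-concatMap : ∀ {B : Set} (h : B → List A) xs →
    length (filter P? (concatMap h xs)) ≡ sum (map (λ x → length (filter P? (h x))) xs)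
  length-filter-concatMap h []       = refl
  length-filter-concatMap h (x ∷ xs) = begin
    length (filter P? (h x ++ concatMap h xs))                      ≡⟨ cong length (filter-++ P? (h x) (concatMap h xs)) ⟩
    length (filter P? (h x) ++ filter P? (concatMap h xs))          ≡⟨ length-++ (filter P? (h x)) ⟩
    length (filter P? (h x)) + length (filter P? (concatMap h xs))  ≡⟨ cong (length (filter P? (h x)) +_) (length-filter-concatMap h xs) ⟩
    length (filter P? (h x)) + sum (map (λ x → length (filter P? (h x))) xs) ∎

sum-map-tabulate-except-last : ∀ n {B : Set} (g : Fin (suc n) → B) (h : B → ℕ) {c} →
  (∀ y → y ≢ fromℕ n → h (g y) ≡ c) → sum (map h (tabulate g)) ≡ n * c + h (g (fromℕ n))
sum-map-tabulate-except-last zero    g h _     = +-identityʳ (h (g zero))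
sum-map-tabulate-except-last (suc n) g h {c} h∘g≡c = begin
  h (g zero) + sum (map h (tabulate (g ∘ suc)))  ≡⟨ cong₂ _+_ (h∘g≡c zero (λ ())) (sum-map-tabulate-except-last n (g ∘ suc) h h∘g∘suc≡c) ⟩
  c + (n * c + h (g (fromℕ (suc n))))            ≡⟨ +-assoc c (n * c) _ ⟨
  suc n * c + h (g (fromℕ (suc n)))              ∎
  where
  h∘g∘suc≡c : ∀ y → y ≢ fromℕ n → h (g (suc y)) ≡ c
  h∘g∘suc≡c y y≢last = h∘g≡c (suc y) (y≢last ∘ fsuc-injective)

sum-zipWith-table : ∀ g n (h k : ℕ → ℕ) →
  sum (zipWith _*_ (map h (applyUpTo k (suc n))) (table g n)) ≡ ∑ (suc n) (λ i → h (k i) * invert g (n ∸ i))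
sum-zipWith-table g zero    h k = refl
sum-zipWith-table g (suc n) h k = cong (h (k 0) * invert g (suc n) +_) (sum-zipWith-table g n h (k ∘ suc))

invert-suc : ∀ g n → invert g (suc n) ≡ ∑ (suc n) (λ i → g (suc i) * invert g (n ∸ i))
invert-suc g n = sum-zipWith-table g n (g ∘ suc) (λ i → i)

invert-unique : ∀ g (h : ℕ → ℕ) → h 0 ≡ 1 →
  (∀ n → h (suc n) ≡ ∑ (suc n) (λ i → g (suc i) * h (n ∸ i))) → ∀ n → h n ≡ invert g n
invert-unique g h h0 hsuc = <-rec (λ n → h n ≡ invert g n) step
  where
  step : ∀ n → (∀ {m} → m < n → h m ≡ invert g m) → h n ≡ invert g n
  step zero    _  = h0
  step (suc n) ih = begin
    h (suc n)                                        ≡⟨ hsuc n ⟩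
    ∑ (suc n) (λ i → g (suc i) * h (n ∸ i))          ≡⟨ ∑-cong (suc n) (λ i _ → cong (g (suc i) *_) (ih (s≤s (m∸n≤m n i)))) ⟩
    ∑ (suc n) (λ i → g (suc i) * invert g (n ∸ i))   ≡⟨ invert-suc g n ⟨
    invert g (suc n)                                 ∎

sum-map-upTo-∸ : ∀ (F : ℕ → ℕ) n k → sum (map F (upTo ((n + 1) ∸ suc k))) ≡ ∑ (n ∸ k) F
sum-map-upTo-∸ F n k =
  trans (sum-map-applyUpTo F (λ i → i) ((n + 1) ∸ suc k)) (cong (λ r → ∑ (r ∸ suc k) F) (+-comm n 1))

cg-suc : ∀ g n k → cg g n (suc k) ≡ ∑ (n ∸ k) (λ i → g (suc i) * cg g (n ∸ suc i) k)
cg-suc g zero    k = sum-map-upTo-∸ _ zero k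
cg-suc g (suc n) k = sum-map-upTo-∸ _ (suc n) k

isZero : ∀ {n} → Fin n → Bool
isZero zero    = true
isZero (suc _) = false

MayFollow : ∀ {b l} → Bool → Vec (Fin (suc (suc b))) l → Set
MayFollow false _       = ⊤
MayFollow true  []      = ⊤
MayFollow true  (y ∷ _) = y ≢ suc zero

mayFollow? : ∀ {b l} s (w : Vec (Fin (suc (suc b))) l) → Dec (MayFollow s w)
mayFollow? false _       = yes tt
mayFollow? true  []      = yes tt
mayFollow? true  (y ∷ _) = ¬? (y F.≟ suc zero)

mayFollow-∷ : ∀ {b l} s {x : Fin (suc (suc b))} (w : Vec (Fin (suc (suc b))) l) → x ≢ suc zero → MayFollow s (x ∷ w)
mayFollow-∷ false w _   = tt
mayFollow-∷ true  w x≢1 = x≢1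

avoids01-∷⁻ : ∀ {b l} (x : Fin (suc (suc b))) (w : Vec (Fin (suc (suc b))) l) →
  Avoids01 (x ∷ w) → MayFollow (isZero x) w × Avoids01 w
avoids01-∷⁻ zero    []      _          = tt , []
avoids01-∷⁻ (suc x) []      _          = tt , []
avoids01-∷⁻ zero    (y ∷ w) (0≁y ∷ av) = (λ y≡1 → 0≁y (refl , y≡1)) , av
avoids01-∷⁻ (suc x) (y ∷ w) (_   ∷ av) = tt , av

avoids01-∷⁺ : ∀ {b l} (x : Fin (suc (suc b))) (w : Vec (Fin (suc (suc b))) l) →
  MayFollow (isZero x) w → Avoids01 w → Avoids01 (x ∷ w)
avoids01-∷⁺ x       []      _           _  = [-]
avoids01-∷⁺ zero    (y ∷ w) w-mayFollow av = (λ (_ , y≡1) → w-mayFollow y≡1) ∷ av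
avoids01-∷⁺ (suc x) (y ∷ w) _           av = (λ ()) ∷ av

-- avoiding a s l j counts the 01-free words of length l over {0,…,a+2} with exactly j top
-- letters a+2 that, if s = true, do not start with 1. Such a word starts with 0, with one of the
-- nonZeroStarts a s admissible letters among 1,…,a+1, or with the top letter; topLed a l j counts
-- those that are empty or start with the top letter.
nonZeroStarts : ℕ → Bool → ℕ
nonZeroStarts a true  = a
nonZeroStarts a false = suc a

mutual
  avoiding : ℕ → Bool → ℕ → ℕ → ℕ
  avoiding a s zero    j = topLed a zero j
  avoiding a s (suc l) j = avoiding a true l j + nonZeroStarts a s * avoiding a false l j + topLed a (suc l) j

  topLed : ℕ → ℕ → ℕ → ℕ
  topLed a zero    zero    = 1
  topLed a zero    (suc j) = 0
  topLed a (suc l) zero    = 0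
  topLed a (suc l) (suc j) = avoiding a false l j

topFree : ℕ → Bool → ℕ → ℕ
topFree a s l = avoiding a s l 0

topFree-suc : ∀ a s l → topFree a s (suc l) ≡ topFree a true l + nonZeroStarts a s * topFree a false l
topFree-suc a s l = +-identityʳ _

nonZeroStarts-suc : ∀ a s → nonZeroStarts (suc a) s ≡ suc (nonZeroStarts a s)
nonZeroStarts-suc a true  = refl
nonZeroStarts-suc a false = refl

mutual
  avoiding-vanishes : ∀ a s {l j} → l < j → avoiding a s l j ≡ 0
  avoiding-vanishes a s {zero}  l<j = topLed-vanishes a l<j
  avoiding-vanishes a s {suc l} l<j
    rewrite avoiding-vanishes a true (<⇒≤ l<j) | avoiding-vanishes a false (<⇒≤ l<j) | topLed-vanishes a l<j
    = trans (+-identityʳ _) (*-zeroʳ (nonZeroStarts a s))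

  topLed-vanishes : ∀ a {l j} → l < j → topLed a l j ≡ 0
  topLed-vanishes a {zero}  {suc j} _         = refl
  topLed-vanishes a {suc l} {suc j} (s≤s l<j) = avoiding-vanishes a false l<j

-- The i-th term counts the words whose first top letter is at position i.
recurrence⇒convolution : ∀ a (T : ℕ → ℕ) (X : Bool → ℕ → ℕ) →
  (∀ s → X s 0 ≡ T 0) →
  (∀ s l → X s (suc l) ≡ X true l + nonZeroStarts a s * X false l + T (suc l)) →
  ∀ s l → X s l ≡ ∑ (suc l) (λ i → topFree a s i * T (l ∸ i))
recurrence⇒convolution a T X X0 Xsuc s zero = trans (X0 s) (sym (trans (+-identityʳ _) (*-identityˡ (T 0))))
recurrence⇒convolution a T X X0 Xsuc s (suc l) = begin
  X s (suc l)                                               ≡⟨ Xsuc s l ⟩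
  X true l + r * X false l + T (suc l)                      ≡⟨ cong₂ (λ x y → x + r * y + T (suc l)) (conv true l) (conv false l) ⟩
  ∑ (suc l) (P true) + r * ∑ (suc l) (P false) + T (suc l)  ≡⟨ cong (_+ T (suc l)) combine ⟩
  ∑ (suc l) Q + T (suc l)                                   ≡⟨ +-comm (∑ (suc l) Q) (T (suc l)) ⟩
  T (suc l) + ∑ (suc l) Q                                   ≡⟨ cong (_+ ∑ (suc l) Q) (*-identityˡ (T (suc l))) ⟨
  ∑ (suc (suc l)) (λ i → topFree a s i * T (suc l ∸ i))     ∎
  where
  conv : ∀ s l → X s l ≡ ∑ (suc l) (λ i → topFree a s i * T (l ∸ i))
  conv = recurrence⇒convolution a T X X0 Xsuc
  r : ℕ
  r = nonZeroStarts a s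
  P : Bool → ℕ → ℕ
  P s′ i = topFree a s′ i * T (l ∸ i)
  Q : ℕ → ℕ
  Q i = topFree a s (suc i) * T (l ∸ i)
  pointwise : ∀ i → P true i + r * P false i ≡ Q i
  pointwise i = begin
    x * t + r * (y * t)  ≡⟨ cong (x * t +_) (*-assoc r y t) ⟨
    x * t + r * y * t    ≡⟨ *-distribʳ-+ t x (r * y) ⟨
    (x + r * y) * t      ≡⟨ cong (_* t) (topFree-suc a s i) ⟨
    Q i                  ∎
    where
    x = topFree a true i
    y = topFree a false i
    t = T (l ∸ i)
  combine : ∑ (suc l) (P true) + r * ∑ (suc l) (P false) ≡ ∑ (suc l) Q
  combine = begin
    ∑ (suc l) (P true) + r * ∑ (suc l) (P false)          ≡⟨ cong (∑ (suc l) (P true) +_) (∑-*ˡ (suc l) r (P false)) ⟨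
    ∑ (suc l) (P true) + ∑ (suc l) (λ i → r * P false i)  ≡⟨ ∑-+ (suc l) (P true) (λ i → r * P false i) ⟨
    ∑ (suc l) (λ i → P true i + r * P false i)            ≡⟨ ∑-cong (suc l) (λ i _ → pointwise i) ⟩
    ∑ (suc l) Q                                           ∎

avoiding-convolution : ∀ a s l k → avoiding a s l k ≡ ∑ (suc l) (λ i → topFree a s i * topLed a (l ∸ i) k)
avoiding-convolution a s l k =
  recurrence⇒convolution a (λ m → topLed a m k) (λ s l → avoiding a s l k) (λ _ → refl) (λ _ _ → refl) s l

topFree-zero-true : ∀ l → topFree 0 true l ≡ 1
topFree-zero-true zero    = refl
topFree-zero-true (suc l) = trans (topFree-suc 0 true l) (trans (+-identityʳ _) (topFree-zero-true l))

topFree-zero-false : ∀ l → topFree 0 false l ≡ suc l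
topFree-zero-false zero    = refl
topFree-zero-false (suc l) =
  trans (topFree-suc 0 false l) (cong₂ _+_ (topFree-zero-true l) (trans (*-identityˡ _) (topFree-zero-false l)))

f-suc : ∀ a l → f a (suc l) ≡ topFree a false l
f-suc zero    l = sym (topFree-zero-false l)
f-suc (suc a) l = sym (invert-unique (f a) h refl h-suc (suc l))
  where
  -- Over {0,…,a+2}, h n counts the 01-free words of length n that are empty or start with a+2.
  h : ℕ → ℕ
  h zero    = 1
  h (suc n) = topFree (suc a) false n
  recurrence : ∀ s l → topFree (suc a) s (suc l) ≡ topFree (suc a) true l + nonZeroStarts a s * topFree (suc a) false l + h (suc l)
  recurrence s l = begin
    topFree (suc a) s (suc l)                ≡⟨ topFree-suc (suc a) s l ⟩
    x + nonZeroStarts (suc a) s * y          ≡⟨ cong (λ r → x + r * y) (nonZeroStarts-suc a s) ⟩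
    x + (y + nonZeroStarts a s * y)          ≡⟨ cong (x +_) (+-comm y _) ⟩
    x + (nonZeroStarts a s * y + y)          ≡⟨ +-assoc x _ y ⟨
    x + nonZeroStarts a s * y + y            ∎
    where
    x = topFree (suc a) true l
    y = topFree (suc a) false l
  h-suc : ∀ n → h (suc n) ≡ ∑ (suc n) (λ i → f a (suc i) * h (n ∸ i))
  h-suc n = begin
    topFree (suc a) false n                           ≡⟨ recurrence⇒convolution a h (topFree (suc a)) (λ _ → refl) recurrence false n ⟩
    ∑ (suc n) (λ i → topFree a false i * h (n ∸ i))   ≡⟨ ∑-cong (suc n) (λ i _ → cong (_* h (n ∸ i)) (f-suc a i)) ⟨
    ∑ (suc n) (λ i → f a (suc i) * h (n ∸ i))         ∎

topLed-convolution : ∀ a n k → ∑ n (λ i → topFree a false i * topLed a (n ∸ suc i) k) ≡ topLed a n (suc k)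
topLed-convolution a zero    k = refl
topLed-convolution a (suc n) k = sym (avoiding-convolution a false n k)

cg-f≡topLed : ∀ a n k → cg (f a) n k ≡ topLed a n k
cg-f≡topLed a zero    zero    = refl
cg-f≡topLed a (suc n) zero    = refl
cg-f≡topLed a n       (suc k) = begin
  cg (f a) n (suc k)                                       ≡⟨ cg-suc (f a) n k ⟩
  ∑ (n ∸ k) (λ i → f a (suc i) * cg (f a) (n ∸ suc i) k)   ≡⟨ ∑-cong (n ∸ k) (λ i _ → cong₂ _*_ (f-suc a i) (cg-f≡topLed a (n ∸ suc i) k)) ⟩
  ∑ (n ∸ k) G                                              ≡⟨ ∑-truncate G (m∸n≤m n k) G-vanishes ⟨
  ∑ n G                                                    ≡⟨ topLed-convolution a n k ⟩
  topLed a n (suc k)                                       ∎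
  where
  G : ℕ → ℕ
  G i = topFree a false i * topLed a (n ∸ suc i) k
  G-vanishes : ∀ i → n ∸ k ≤ i → i < n → G i ≡ 0
  G-vanishes i n∸k≤i i<n =
    trans (cong (topFree a false i *_) (topLed-vanishes a (n∸k≤i⇒n∸1+i<k n∸k≤i i<n))) (*-zeroʳ (topFree a false i))

module WordCount (a : ℕ) where

  Letter : Set
  Letter = Fin (3 + a)

  top : Letter
  top = fromℕ (2 + a)

  numTop-∷-nonTop : ∀ {l x} (w : Vec Letter l) → x ≢ top → numTop {suc a} (x ∷ w) ≡ numTop {suc a} w
  numTop-∷-nonTop {x = x} w x≢top rewrite dec-false (x F.≟ top) x≢top = refl

  numTop-∷-top : ∀ {l} (w : Vec Letter l) → numTop {suc a} (top ∷ w) ≡ suc (numTop {suc a} w)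
  numTop-∷-top w rewrite dec-true (top F.≟ top) refl = refl

  GoodAfter : Bool → ℕ → ∀ {l} → Pred (Vec Letter l) 0ℓ
  GoodAfter s j w = Good (suc a) j w × MayFollow s w

  goodAfter? : ∀ s j {l} → Decidable (GoodAfter s j {l})
  goodAfter? s j w = good? (suc a) j w ×-dec mayFollow? s w

  goodAfter-∷-nonTop : ∀ {s j l x} → x ≢ top → (∀ {l} (w : Vec Letter l) → MayFollow s (x ∷ w)) →
    (λ (w : Vec Letter l) → GoodAfter s j (x ∷ w)) ≐ GoodAfter (isZero x) j
  goodAfter-∷-nonTop {x = x} x≢top x∷w-mayFollow =
    (λ {w} ((tops , av) , _) →
      (trans (sym (numTop-∷-nonTop w x≢top)) tops , proj₂ (avoids01-∷⁻ x w av)) , proj₁ (avoids01-∷⁻ x w av)) ,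
    (λ {w} ((tops , av) , w-mayFollow) →
      (trans (numTop-∷-nonTop w x≢top) tops , avoids01-∷⁺ x w w-mayFollow av) , x∷w-mayFollow w)

  goodAfter-∷-top : ∀ {s j l} → (λ (w : Vec Letter l) → GoodAfter s (suc j) (top ∷ w)) ≐ GoodAfter false j
  goodAfter-∷-top {s} =
    (λ {w} ((tops , av) , _) →
      (suc-injective (trans (sym (numTop-∷-top w)) tops) , proj₂ (avoids01-∷⁻ top w av)) , proj₁ (avoids01-∷⁻ top w av)) ,
    (λ {w} ((tops , av) , w-mayFollow) →
      (trans (numTop-∷-top w) (cong suc tops) , avoids01-∷⁺ top w w-mayFollow av) , mayFollow-∷ s w (λ ()))

  ¬goodAfter-∷-top : ∀ {s l} (w : Vec Letter l) → ¬ GoodAfter s 0 (top ∷ w)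
  ¬goodAfter-∷-top w ((tops , _) , _) = 1+n≢0 (trans (sym (numTop-∷-top w)) tops)

  ¬goodAfter-∷-one : ∀ {j l} (w : Vec Letter l) → ¬ GoodAfter true j (suc zero ∷ w)
  ¬goodAfter-∷-one w (_ , 1≢1) = 1≢1 refl

  #GoodAfter : Bool → ℕ → ∀ {l} → List (Vec Letter l) → ℕ
  #GoodAfter s j ws = length (filter (goodAfter? s j) ws)

  #GoodAfter-∷-nonTop : ∀ {s j l} x → x ≢ top → (∀ {l} (w : Vec Letter l) → MayFollow s (x ∷ w)) →
    (ws : List (Vec Letter l)) → #GoodAfter s j (map (x ∷_) ws) ≡ #GoodAfter (isZero x) j ws
  #GoodAfter-∷-nonTop {s} {j} x x≢top mayFollow =
    length-filter-map-≐ (goodAfter? s j) (goodAfter? (isZero x) j) (x ∷_) (goodAfter-∷-nonTop x≢top mayFollow)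

  #GoodAfter-∷-top : ∀ {s j l} (ws : List (Vec Letter l)) → #GoodAfter s (suc j) (map (top ∷_) ws) ≡ #GoodAfter false j ws
  #GoodAfter-∷-top {s} {j} = length-filter-map-≐ (goodAfter? s (suc j)) (goodAfter? false j) (top ∷_) goodAfter-∷-top

  #GoodAfter-∷-top-zero : ∀ {s l} (ws : List (Vec Letter l)) → #GoodAfter s 0 (map (top ∷_) ws) ≡ 0
  #GoodAfter-∷-top-zero {s} = length-filter-map-none (goodAfter? s 0) (top ∷_) ¬goodAfter-∷-top

  #GoodAfter-∷-one : ∀ {j l} (ws : List (Vec Letter l)) → #GoodAfter true j (map (suc zero ∷_) ws) ≡ 0
  #GoodAfter-∷-one {j} = length-filter-map-none (goodAfter? true j) (suc zero ∷_) ¬goodAfter-∷-one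

  #GoodAfter-words : ∀ s l j → #GoodAfter s j (words (3 + a) l) ≡ avoiding a s l j
  #GoodAfter-words true  zero zero    = refl
  #GoodAfter-words false zero zero    = refl
  #GoodAfter-words s     zero (suc j) = refl
  #GoodAfter-words s     (suc l) j    = begin
      #GoodAfter s j (words (3 + a) (suc l))
    ≡⟨ length-filter-concatMap (goodAfter? s j) (λ x → map (x ∷_) ws) (allFin (3 + a)) ⟩
      C zero + (C (suc zero) + sum (map C (tabulate (2 F.↑ʳ_))))
    ≡⟨ cong (λ t → C zero + (C (suc zero) + t)) (sum-map-tabulate-except-last a (2 F.↑ʳ_) C C-middle) ⟩
      C zero + (C (suc zero) + (a * Y + C top))
    ≡⟨ cong (C zero +_) (+-assoc (C (suc zero)) (a * Y) (C top)) ⟨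
      C zero + (C (suc zero) + a * Y + C top)
    ≡⟨ +-assoc (C zero) (C (suc zero) + a * Y) (C top) ⟨
      C zero + (C (suc zero) + a * Y) + C top
    ≡⟨ cong₂ _+_ (cong₂ _+_ C-zero (C-one s)) (C-top j) ⟩
      avoiding a true l j + nonZeroStarts a s * Y + topLed a (suc l) j
    ∎
    where
    ws : List (Vec Letter l)
    ws = words (3 + a) l
    Y : ℕ
    Y = avoiding a false l j
    C : Letter → ℕ
    C x = #GoodAfter s j (map (x ∷_) ws)
    C-zero : C zero ≡ avoiding a true l j
    C-zero = trans (#GoodAfter-∷-nonTop zero (λ ()) (λ w → mayFollow-∷ s w (λ ())) ws) (#GoodAfter-words true l j)
    C-one : ∀ s′ → #GoodAfter s′ j (map (suc zero ∷_) ws) + a * Y ≡ nonZeroStarts a s′ * Y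
    C-one true  = cong (_+ a * Y) (#GoodAfter-∷-one ws)
    C-one false = cong (_+ a * Y) (trans (#GoodAfter-∷-nonTop {false} (suc zero) (λ ()) (λ _ → tt) ws) (#GoodAfter-words false l j))
    C-middle : ∀ y → y ≢ fromℕ a → C (suc (suc y)) ≡ Y
    C-middle y y≢last = trans
      (#GoodAfter-∷-nonTop (suc (suc y)) (y≢last ∘ fsuc-injective ∘ fsuc-injective) (λ w → mayFollow-∷ s w (λ ())) ws)
      (#GoodAfter-words false l j)
    C-top : ∀ j → #GoodAfter s j (map (top ∷_) ws) ≡ topLed a (suc l) j
    C-top zero    = #GoodAfter-∷-top-zero ws
    C-top (suc j) = trans (#GoodAfter-∷-top ws) (#GoodAfter-words false l j)

  countWords-avoiding : ∀ l j → countWords (suc a) l j ≡ avoiding a false l j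
  countWords-avoiding l j =
    trans (cong length (filter-≐ (good? (suc a) j) (goodAfter? false j) ((_, tt) , proj₁) (words (3 + a) l)))
          (#GoodAfter-words false l j)

corollary25 : (m n k : ℕ) → 1 ≤ m → 1 ≤ k → k ≤ n →
    c m n k ≡ countWords m (n ∸ 1) (k ∸ 1)
corollary25 (suc a) (suc n) (suc k) _ _ _ = begin
  c (suc a) (suc n) (suc k)  ≡⟨ cg-f≡topLed a (suc n) (suc k) ⟩
  avoiding a false n k       ≡⟨ WordCount.countWords-avoiding a n k ⟨
  countWords (suc a) n k     ∎
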